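{- Let $\mathcal T$ be a finite rooted tree and consider the rewriting system on paths of $\mathbb G(\mathcal T)$ given by $p_1,x,y,z,p_2\longrightarrow p_1,x,z,p_2$ whenever $x,y,z$ are in one of the four configurations (a)–(d). This rewriting system is terminating and confluent. It is complete, in the sense that any two paths with the same pair of endpoints are related by a zigzag of rewriting steps, and sound, in the sense that any such zigzag relates two paths with the same endpoints. Its normal forms are exactly the paths of type I or type II, and they are exactly the min-paths (paths of minimal length between their endpoints).
   Context: $\mathbb G(\mathcal T)$ is the graph whose vertices are the edges of $\mathcal T$, two vertices being adjacent iff, as edges of $\mathcal T$, they share a node. The level of a vertex $e$ is the depth in $\mathcal T$ of the child endpoint of $e$ (the root has depth $0$). An edge $\{e,f\}$ of $\mathbb G(\mathcal T)$ is solid if the common node of $e$ and $f$ is the child endpoint of one of them and the parent endpoint of the other (so their levels differ by $1$), and dashed if it is the parent endpoint of both (same level). A path is a sequence of pairwise distinct vertices in which consecutive vertices are adjacent; its length is its number of edges. A descending path is a path along solid edges in which the level decreases by $1$ at each step; an ascending path is the reverse of a descending one. A path from $u$ to $v$ is of type I if it is descending or ascending; it is of type II if it has the form $q_1,u',v',q_2$ where $q_1,u'$ is a descending path ending at $u'$, $\{u',v'\}$ is a dashed edge, and $v',q_2$ is an ascending path starting at $v'$. Configurations for three consecutive vertices $x,y,z$ of a path: (a) $\{x,y\}$ and $\{y,z\}$ are both dashed; (b) $\{x,y\}$ and $\{y,z\}$ are solid and $y$ has level one less than $x$ and $z$; (c) $\{x,y\}$ is dashed and $\{y,z\}$ is solid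 with $z$ one level below $y$; (d) $\{x,y\}$ is solid with $x$ one level below $y$, and $\{y,z\}$ is dashed. (In each case $x$ and $z$ are adjacent, so the result is again a path.) -}

module Defs where

open import Data.Nat using (ℕ; zero; suc; _≤_)
open import Data.Fin using (Fin; zero; suc; toℕ)
open import Data.List using (List; []; _∷_; _++_; [_]; reverse; length; head; last)
open import Data.List.Relation.Unary.Linked using (Linked)
open import Data.List.Relation.Unary.Unique.Propositional using (Unique)
open import Data.Product using (Σ; ∃; _×_; _,_)
open import Data.Sum using (_⊎_)
open import Relation.Nullary using (¬_)
open import Relation.Binary.PropositionalEquality using (_≡_; _≢_)
open import Relation.Binary.Construct.Closure.ReflexiveTransitive using (Star)

-- A rooted tree with  suc n  nodes is encoded with nodes  Fin (suc n),
-- root  zero, and each non-root node  suc i  (i : Fin n) has parent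
-- node  parent i , whose index is at most i (so the parent relation is
-- acyclic and every node reaches the root).  Every finite rooted tree is
-- isomorphic to one of this form (number the nodes in BFS order).

record Tree (n : ℕ) : Set where
  field
    parent  : Fin n → Fin (suc n)
    ordered : ∀ i → toℕ (parent i) ≤ toℕ i

open Tree public

Node : ℕ → Set
Node n = Fin (suc n)

-- Edges of T: the edge joining the non-root node  suc e  to its parent.
-- (Edges of a rooted tree are in bijection with its non-root nodes.)
Edge : ℕ → Set
Edge n = Fin n

module _ {n : ℕ} (T : Tree n) where

  childEnd : Edge n → Node n
  childEnd e = suc e

  parentEnd : Edge n → Node n
  parentEnd e = parent T e

  -- depth of a node (root has depth 0); the fuel  n  suffices since
  -- parent indices strictly decrease along the path to the root.
  depthAux : ℕ → Node n → ℕ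
  depthAux _        zero    = 0
  depthAux zero     (suc i) = 0
  depthAux (suc k)  (suc i) = suc (depthAux k (parent T i))

  depth : Node n → ℕ
  depth v = depthAux n v

  level : Edge n → ℕ
  level e = depth (childEnd e)

  IsEnd : Edge n → Node n → Set
  IsEnd e v = (v ≡ childEnd e) ⊎ (v ≡ parentEnd e)

  Adj : Edge n → Edge n → Set
  Adj e f = e ≢ f × ∃ λ v → IsEnd e v × IsEnd f v

  Solid : Edge n → Edge n → Set
  Solid e f = e ≢ f × ∃ λ v →
      (v ≡ childEnd e × v ≡ parentEnd f) ⊎ (v ≡ childEnd f × v ≡ parentEnd e)

  Dashed : Edge n → Edge n → Set
  Dashed e f = e ≢ f × ∃ λ v → v ≡ parentEnd e × v ≡ parentEnd f

  IsPath : List (Edge n) → Set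
  IsPath p = ¬ (p ≡ []) × Unique p × Linked Adj p

  SameEnds : List (Edge n) → List (Edge n) → Set
  SameEnds p q = head p ≡ head q × last p ≡ last q

  DescStep : Edge n → Edge n → Set
  DescStep x y = Solid x y × level x ≡ suc (level y)

  Descending : List (Edge n) → Set
  Descending p = IsPath p × Linked DescStep p

  Ascending : List (Edge n) → Set
  Ascending p = Descending (reverse p)

  TypeI : List (Edge n) → Set
  TypeI p = Descending p ⊎ Ascending p

  TypeII : List (Edge n) → Set
  TypeII p = IsPath p × ∃ λ q₁ → ∃ λ u → ∃ λ v → ∃ λ q₂ →
      p ≡ q₁ ++ u ∷ v ∷ q₂ ×
      Descending (q₁ ++ [ u ]) × Dashed u v × Ascending (v ∷ q₂)

  MinPath : List (Edge n) → Set
  MinPath p = IsPath p × (∀ q → IsPath q → SameEnds p q → length p ≤ length q)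

  -- the four configurations (a)–(d) for consecutive vertices x,y,z
  -- ("below" = one level closer to the root, i.e. level smaller by 1)
  Config : Edge n → Edge n → Edge n → Set
  Config x y z =
      (Dashed x y × Dashed y z)
    ⊎ (Solid x y × Solid y z × level x ≡ suc (level y)
                             × level z ≡ suc (level y))
    ⊎ (Dashed x y × Solid y z × level y ≡ suc (level z))
    ⊎ (Solid x y × level y ≡ suc (level x) × Dashed y z)

  data _⟶_ : List (Edge n) → List (Edge n) → Set where
    step : ∀ p₁ x y z p₂ →
           IsPath (p₁ ++ x ∷ y ∷ z ∷ p₂) →
           IsPath (p₁ ++ x ∷ z ∷ p₂) →
           Config x y z →
           (p₁ ++ x ∷ y ∷ z ∷ p₂) ⟶ (p₁ ++ x ∷ z ∷ p₂)

module Submission where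

-- Adjacent vertices x, y of G(T) (edges of T) are linked in exactly one of
-- three ways: y is the parent edge of x (Down), x is the parent edge of y
-- (Up), or x and y hang from the same node (Sib); the level changes by -1,
-- +1 and 0 respectively.  A *valley* is a path that descends, takes at most
-- one dashed step and then ascends; valleys are exactly the paths of type I
-- or II (valley-type, type-valley).  Two facts carry the proof:
--
--  * valleys are determined by their endpoints (valley-unique): the lowest
--    vertices of a valley from e to f are ancestors of e and of f at heights
--    a and b hanging from a common node, and counting levels shows that no
--    other heights are possible (floor-unique);
--  * every path is a valley or contains a redex (valley-or-redex), found by
--    scanning from the right; steps keep the endpoints and shorten paths.
--
-- Hence every path reduces to the unique valley with its endpoints
-- (common-valley), and the theorem follows: termination by length,
-- confluence and completeness through the common valley, soundness since
-- steps keep endpoints, and "normal form = valley = min-path" because a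
-- reduct of a valley would normalise to a strictly shorter valley with the
-- same endpoints.

open import Defs
open import Data.Nat using (ℕ; zero; suc; _+_; _≤_; _<_; s≤s)
open import Data.Nat.Properties
  using (suc-injective; 1+n≢n; ≤-refl; ≤-trans; <⇒≤; ≤-reflexive; <-asym; <-irrefl;
         <-trans; ≤-total; ≤⇒≯; +-identityʳ; +-suc; +-assoc; +-cancelʳ-≡; m≤n⇒∃[o]m+o≡n)
open import Data.Nat.Induction using (<-wellFounded)
open import Data.Fin using (suc; toℕ)
import Data.Fin.Properties as Fin
open import Data.List using (List; []; _∷_; _++_; [_]; reverse; length; head; last; foldl)
open import Data.List.Properties using (++-assoc; length-reverse; reverse-involutive)
open import Data.List.Relation.Unary.All using (All; []; _∷_)
open import Data.List.Relation.Unary.AllPairs using (AllPairs; []; _∷_)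
import Data.List.Relation.Unary.AllPairs as AllPairs
open import Data.List.Relation.Unary.Linked using (Linked; []; [-]; _∷_)
import Data.List.Relation.Unary.Linked as Linked
import Data.List.Relation.Unary.Linked.Properties as Linked
open import Data.List.Relation.Unary.Unique.Propositional using (Unique)
open import Data.Maybe using (just)
open import Data.Maybe.Properties using (just-injective)
open import Data.Product using (∃; ∃₂; _×_; _,_; proj₁; proj₂)
open import Data.Sum using (_⊎_; inj₁; inj₂)
open import Data.Empty using (⊥; ⊥-elim)
open import Function using (flip)
open import Function.Bundles using (_⇔_; mk⇔)
open import Relation.Nullary using (¬_)
open import Relation.Binary.Structures using (IsEquivalence)
open import Relation.Binary.PropositionalEquality
  using (_≡_; _≢_; refl; sym; trans; cong; subst; subst₂; module ≡-Reasoning)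
open import Relation.Binary.Construct.Closure.ReflexiveTransitive using (Star; ε; _◅_; _◅◅_)
import Relation.Binary.Construct.Closure.ReflexiveTransitive as Star
open import Relation.Binary.Construct.Closure.Equivalence using (EqClosure)
import Relation.Binary.Construct.Closure.Equivalence as EqClosure
open import Relation.Binary.Construct.Closure.Symmetric using (fwd)
open import Relation.Binary.Rewriting using (StronglyNormalizing; Confluent; IsNormalForm)
open import Induction.WellFounded using (Acc; acc)
import Induction.WellFounded as WF
import Relation.Binary.Construct.On as On

module _ {A : Set} where

  last-++ : ∀ (p : List A) y r → last (p ++ y ∷ r) ≡ last (y ∷ r)
  last-++ []           _ _ = refl
  last-++ (_ ∷ [])     _ _ = refl
  last-++ (_ ∷ x ∷ p)  y r = last-++ (x ∷ p) y r

  head-++ : ∀ (p : List A) {x r s} → head (p ++ x ∷ r) ≡ head (p ++ x ∷ s)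
  head-++ []      = refl
  head-++ (_ ∷ _) = refl

  ++-∷-nonempty : ∀ (p : List A) {x r} → ¬ (p ++ x ∷ r ≡ [])
  ++-∷-nonempty []      ()
  ++-∷-nonempty (_ ∷ _) ()

  length-delete : ∀ (p : List A) {x y r} → length (p ++ x ∷ r) < length (p ++ x ∷ y ∷ r)
  length-delete []      = ≤-refl
  length-delete (_ ∷ p) = s≤s (length-delete p)

  all-delete : ∀ {P : A → Set} p {x y r} → All P (p ++ x ∷ y ∷ r) → All P (p ++ x ∷ r)
  all-delete []      (px ∷ _ ∷ ps) = px ∷ ps
  all-delete (_ ∷ p) (pw ∷ ps)     = pw ∷ all-delete p ps

  allPairs-delete : ∀ {R : A → A → Set} p {x y r} →
                    AllPairs R (p ++ x ∷ y ∷ r) → AllPairs R (p ++ x ∷ r)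
  allPairs-delete []      ((_ ∷ rx) ∷ _ ∷ rs) = rx ∷ rs
  allPairs-delete (_ ∷ p) (rw ∷ rs)          = all-delete p rw ∷ allPairs-delete p rs

  allPairs-skip : ∀ {R : A → A → Set} p {x y z r} → AllPairs R (p ++ x ∷ y ∷ z ∷ r) → R x z
  allPairs-skip []      ((_ ∷ rxz ∷ _) ∷ _) = rxz
  allPairs-skip (_ ∷ p) (_ ∷ rs)            = allPairs-skip p rs

  linked-delete : ∀ {R : A → A → Set} p {x y z r} →
                  Linked R (p ++ x ∷ y ∷ z ∷ r) → R x z → Linked R (p ++ x ∷ z ∷ r)
  linked-delete []          (_ ∷ _ ∷ l) rxz = rxz ∷ l
  linked-delete (_ ∷ [])    (rw ∷ l)    rxz = rw ∷ linked-delete [] l rxz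
  linked-delete (_ ∷ w ∷ p) (rw ∷ l)    rxz = rw ∷ linked-delete (w ∷ p) l rxz

  linked-reverse : ∀ {R : A → A → Set} {xs} → Linked R xs → Linked (flip R) (reverse xs)
  linked-reverse {R} {[]}    _ = []
  linked-reverse {R} {_ ∷ _} l = onto [-] l
    where
      onto : ∀ {x done rest} → Linked (flip R) (x ∷ done) → Linked R (x ∷ rest) →
             Linked (flip R) (foldl (flip _∷_) (x ∷ done) rest)
      onto reversed [-]      = reversed
      onto reversed (r ∷ l') = onto (r ∷ reversed) l'

module ValleyPaths {n : ℕ} (T : Tree n) where

  E : Set
  E = Edge n

  lv : E → ℕ
  lv = level T

  private variable
    a b k : ℕ
    e e' f u u' v v' x y z : E
    xs ys : List E

  depth-fuel : ∀ k k' (w : Node n) → toℕ w ≤ k → toℕ w ≤ k' →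
               depthAux T k w ≡ depthAux T k' w
  depth-fuel _       _        Data.Fin.zero _ _ = refl
  depth-fuel (suc k) (suc k') (suc i) (s≤s i≤k) (s≤s i≤k') =
    cong suc (depth-fuel k k' (parent T i) (≤-trans (ordered T i) i≤k) (≤-trans (ordered T i) i≤k'))

  level-parentEnd : ∀ e → lv e ≡ suc (depth T (parent T e))
  level-parentEnd e = unfold n (Fin.toℕ<n e)
    where
      unfold : ∀ k → toℕ e < k → depthAux T k (suc e) ≡ suc (depth T (parent T e))
      unfold (suc k) (s≤s e≤k) =
        cong suc (depth-fuel k n (parent T e) (≤-trans (ordered T e) e≤k)
                                               (≤-trans (ordered T e) (<⇒≤ (Fin.toℕ<n e))))

  -- y is the parent edge of x: the parent end of x is the child end of y,
  -- so {x, y} is solid and the level drops by one from x to y.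
  Down : E → E → Set
  Down x y = suc y ≡ parent T x

  Up : E → E → Set
  Up x y = Down y x

  -- x and y hang from the same node (every edge is its own sibling).
  Sib : E → E → Set
  Sib x y = parent T x ≡ parent T y

  down-level : Down x y → lv x ≡ suc (lv y)
  down-level {x} d = trans (level-parentEnd x) (cong (λ w → suc (depth T w)) (sym d))

  sib-level : Sib x y → lv x ≡ lv y
  sib-level {x} {y} s =
    trans (level-parentEnd x) (trans (cong (λ w → suc (depth T w)) s) (sym (level-parentEnd y)))

  down-distinct : Down x y → x ≢ y
  down-distinct d refl = 1+n≢n (sym (down-level d))

  down-functional : Down e x → Down e y → x ≡ y
  down-functional d d' = Fin.suc-injective (trans d (sym d'))

  data Link (x y : E) : Set where
    down : Down x y → Link x y
    up   : Up x y → Link x y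
    side : Sib x y → Link x y

  adj-link : Adj T x y → Link x y
  adj-link (x≢y , _ , inj₁ refl , inj₁ c) = ⊥-elim (x≢y (Fin.suc-injective c))
  adj-link (_   , _ , inj₁ refl , inj₂ p) = up p
  adj-link (_   , _ , inj₂ refl , inj₁ c) = down (sym c)
  adj-link (_   , _ , inj₂ refl , inj₂ p) = side p

  link-adj : x ≢ y → Link x y → Adj T x y
  link-adj {x} {y} x≢y (down d) = x≢y , suc y , inj₂ d , inj₁ refl
  link-adj {x} {y} x≢y (up u)   = x≢y , suc x , inj₁ refl , inj₂ u
  link-adj {x} {y} x≢y (side s) = x≢y , parent T x , inj₂ refl , inj₂ s

  down-solid : Down x y → Solid T x y
  down-solid {y = y} d = down-distinct d , suc y , inj₂ (refl , d)

  up-solid : Up x y → Solid T x y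
  up-solid {x} u = (λ x≡y → down-distinct u (sym x≡y)) , suc x , inj₁ (refl , u)

  solid-down : Solid T x y → lv x ≡ suc (lv y) → Down x y
  solid-down (_ , _ , inj₂ (refl , d)) _ = d
  solid-down (_ , _ , inj₁ (refl , u)) l = ⊥-elim (<-asym (≤-reflexive (sym l)) (≤-reflexive (sym (down-level u))))

  solid-up : Solid T x y → lv y ≡ suc (lv x) → Up x y
  solid-up s l = solid-down (flip-solid s) l
    where
      flip-solid : Solid T x y → Solid T y x
      flip-solid (x≢y , w , inj₁ c) = (λ y≡x → x≢y (sym y≡x)) , w , inj₂ c
      flip-solid (x≢y , w , inj₂ c) = (λ y≡x → x≢y (sym y≡x)) , w , inj₁ c

  dashed-sib : Dashed T x y → Sib x y
  dashed-sib (_ , _ , p , q) = trans (sym p) q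

  sib-dashed : Sib x y → x ≢ y → Dashed T x y
  sib-dashed {x} s x≢y = x≢y , parent T x , refl , s

  down-descStep : Down x y → DescStep T x y
  down-descStep d = down-solid d , down-level d

  descStep-down : DescStep T x y → Down x y
  descStep-down (s , l) = solid-down s l

  config-link : Config T x y z → Link x z
  config-link (inj₁ (d₁ , d₂)) = side (trans (dashed-sib d₁) (dashed-sib d₂))
  config-link (inj₂ (inj₁ (s₁ , s₂ , l₁ , l₂))) = side (trans (sym (solid-down s₁ l₁)) (solid-up s₂ l₂))
  config-link (inj₂ (inj₂ (inj₁ (d , s , l)))) = down (trans (solid-down s l) (sym (dashed-sib d)))
  config-link (inj₂ (inj₂ (inj₂ (s , l , d)))) = up (trans (solid-up s l) (dashed-sib d))

  config-a : Sib x y → x ≢ y → Sib y z → y ≢ z → Config T x y z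
  config-a s x≢y s' y≢z = inj₁ (sib-dashed s x≢y , sib-dashed s' y≢z)

  config-b : Down x y → Up y z → Config T x y z
  config-b d u = inj₂ (inj₁ (down-solid d , up-solid u , down-level d , down-level u))

  config-c : Sib x y → x ≢ y → Down y z → Config T x y z
  config-c s x≢y d = inj₂ (inj₂ (inj₁ (sib-dashed s x≢y , down-solid d , down-level d)))

  config-d : Up x y → Sib y z → y ≢ z → Config T x y z
  config-d u s y≢z = inj₂ (inj₂ (inj₂ (up-solid u , down-level u , sib-dashed s y≢z)))

  data Chain : E → ℕ → E → Set where
    []  : Chain e 0 e
    _∷_ : Down e y → Chain y k u → Chain e (suc k) u

  chain-level : Chain e k u → lv e ≡ k + lv u
  chain-level []      = refl
  chain-level (d ∷ c) = trans (down-level d) (cong suc (chain-level c))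

  chain-functional : Chain e k u → Chain e k v → u ≡ v
  chain-functional []      []       = refl
  chain-functional (d ∷ c) (d' ∷ c') with down-functional d d'
  ... | refl = chain-functional c c'

  chain-split : ∀ a → Chain e (a + b) v → ∃ λ u → Chain e a u × Chain u b v
  chain-split zero    c       = _ , [] , c
  chain-split (suc a) (d ∷ c) with chain-split a c
  ... | u , c₁ , c₂ = u , d ∷ c₁ , c₂

  chain-snoc : Chain e k u → Down u v → Chain e (suc k) v
  chain-snoc []      d = d ∷ []
  chain-snoc (d' ∷ c) d = d' ∷ chain-snoc c d

  chain-drop : Chain e a u → Chain e (a + k) u' → Chain u k u'
  chain-drop {a = a} cu c with chain-split a c
  ... | g , cg , cgu' with chain-functional cg cu
  ... | refl = cgu'

  -- Siblings share their parent edge, hence all ancestors at positive height.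
  sib-ancestors : Sib u v → Chain u (suc k) x → Chain v (suc k) y → x ≡ y
  sib-ancestors s (d ∷ c) (d' ∷ c') with Fin.suc-injective (trans d (trans s (sym d')))
  ... | refl = chain-functional c c'

  data Run (R : E → E → Set) : E → List E → E → Set where
    []  : Run R e [] e
    _∷_ : R e y → Run R y xs f → Run R e (y ∷ xs) f

  run-linked : ∀ {R} → Run R e xs f → Linked R (e ∷ xs)
  run-linked []           = [-]
  run-linked (r ∷ [])     = r ∷ [-]
  run-linked (r ∷ r' ∷ q) = r ∷ run-linked (r' ∷ q)

  linked-run : ∀ {R} → Linked R (e ∷ xs) → ∃ (Run R e xs)
  linked-run [-]     = _ , []
  linked-run (r ∷ l) with linked-run l
  ... | f , q = f , r ∷ q

  linked-snoc-run : ∀ {R} q → Linked R (q ++ [ u ]) → ∃₂ λ e xs → q ++ [ u ] ≡ e ∷ xs × Run R e xs u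
  linked-snoc-run []            [-]     = _ , [] , refl , []
  linked-snoc-run (w ∷ [])      (r ∷ [-]) = w , _ , refl , r ∷ []
  linked-snoc-run (w ∷ w' ∷ q) (r ∷ l) with linked-snoc-run (w' ∷ q) l
  ... | _ , _ , refl , run = w , _ , refl , r ∷ run

  run-snoc : ∀ {R} → Run R e xs f → ∃ λ q → e ∷ xs ≡ q ++ [ f ]
  run-snoc []      = [] , refl
  run-snoc {e} (_ ∷ run) with run-snoc run
  ... | q , eq = e ∷ q , cong (e ∷_) eq

  run-last : ∀ {R} → Run R e xs f → last (e ∷ xs) ≡ just f
  run-last []        = refl
  run-last (_ ∷ run) = run-last run

  descent-chain : Run Down e xs u → Chain e (length xs) u
  descent-chain []      = []
  descent-chain (d ∷ r) = d ∷ descent-chain r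

  ascent-chain : Run Up e xs f → Chain f (length xs) e
  ascent-chain []      = []
  ascent-chain (u ∷ r) = chain-snoc (ascent-chain r) u

  descent-unique : Run Down e xs u → Run Down e ys v → length xs ≡ length ys → xs ≡ ys
  descent-unique []      []       _  = refl
  descent-unique (d ∷ r) (d' ∷ r') eq with down-functional d d'
  ... | refl = cong (_ ∷_) (descent-unique r r' (suc-injective eq))

  ascent-unique : Run Up e xs f → Run Up e' ys f → length xs ≡ length ys → e ≡ e' × xs ≡ ys
  ascent-unique []      []        _  = refl , refl
  ascent-unique (u ∷ r) (u' ∷ r') eq with ascent-unique r r' (suc-injective eq)
  ... | refl , refl = down-functional u u' , refl

  data Valley : E → List E → E → Set where
    rising  : Run Up e xs f → Valley e xs f
    falling : Run Down e xs f → Valley e xs f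
    bending : ∀ {e xs u v ys f} →
              Run Down e xs u → Sib u v → u ≢ v → Run Up v ys f → Valley e (xs ++ v ∷ ys) f

  valley-last : Valley e xs f → last (e ∷ xs) ≡ just f
  valley-last (rising r)  = run-last r
  valley-last (falling r) = run-last r
  valley-last (bending {e} {xs} {v = v} {ys} _ _ _ r) = trans (last-++ (e ∷ xs) v ys) (run-last r)

  data Meet : ℕ → ℕ → E → E → Set where
    at-start : Meet 0 b u u
    at-end   : Meet a 0 u u
    across   : Sib u v → u ≢ v → Meet a b u v

  meet-sib : Meet a b u v → Sib u v
  meet-sib at-start     = refl
  meet-sib at-end       = refl
  meet-sib (across s _) = s

  -- Falling and rising at least once and then meeting in a single vertex
  -- is not allowed: that vertex would be passed twice.
  meet-not-deeper : Meet (suc a) (suc b) u u → ⊥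
  meet-not-deeper (across _ u≢u) = u≢u refl

  record Floor (e f : E) : Set where
    constructor floor
    field
      falls rises : ℕ
      lowˡ lowʳ   : E
      from-start  : Chain e falls lowˡ
      from-end    : Chain f rises lowʳ
      meet        : Meet falls rises lowˡ lowʳ

  open Floor

  valley-floor : Valley e xs f → Floor e f
  valley-floor (rising r)         = floor _ _ _ _ [] (ascent-chain r) at-start
  valley-floor (falling r)        = floor _ _ _ _ (descent-chain r) [] at-end
  valley-floor (bending r s ne q) = floor _ _ _ _ (descent-chain r) (ascent-chain q) (across s ne)

  -- If floor B falls k steps more than floor A, then it also rises k steps
  -- more, and its bottoms are reached from A's by k Down steps: count levels,
  -- using that the two bottoms of a floor share their level.
  floor-beyond : (A B : Floor e f) → falls A + k ≡ falls B →
                 rises A + k ≡ rises B × Chain (lowˡ A) k (lowˡ B) × Chain (lowʳ A) k (lowʳ B)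
  floor-beyond {k = d} (floor a b u v cu cv m) (floor _ b' u' v' cu' cv' m') refl =
    rises-eq , chain-drop cu cu' , chain-drop cv (subst (λ i → Chain _ i v') (sym rises-eq) cv')
    where
      open ≡-Reasoning
      rises-eq : b + d ≡ b'
      rises-eq = +-cancelʳ-≡ (lv u') (b + d) b' (begin
        b + d + lv u'    ≡⟨ +-assoc b d (lv u') ⟩
        b + (d + lv u')  ≡⟨ cong (b +_) (chain-level (chain-drop cu cu')) ⟨
        b + lv u         ≡⟨ cong (b +_) (sib-level (meet-sib m)) ⟩
        b + lv v         ≡⟨ chain-level cv ⟨
        lv _             ≡⟨ chain-level cv' ⟩
        b' + lv v'       ≡⟨ cong (b' +_) (sib-level (meet-sib m')) ⟨
        b' + lv u'       ∎)

  -- Vertices k > 0 Down steps beyond two siblings coincide, so they cannot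
  -- be the bottoms of a floor: the offset k is zero.
  offset-zero : ∀ k → Sib u v → Chain u k u' → Chain v k v' → Meet (a + k) (b + k) u' v' → k ≡ 0
  offset-zero zero    _ _  _  _ = refl
  offset-zero {u' = w} {a = a} {b = b} (suc k) s cu cv m with sib-ancestors s cu cv
  ... | refl = ⊥-elim (meet-not-deeper (subst₂ (λ i j → Meet i j w w) (+-suc a k) (+-suc b k) m))

  floor-no-deeper : (A B : Floor e f) → falls A ≤ falls B → falls A ≡ falls B × rises A ≡ rises B
  floor-no-deeper A B A≤B with m≤n⇒∃[o]m+o≡n A≤B
  ... | d , falls-eq with floor-beyond A B falls-eq
  ... | rises-eq , left , right
    with offset-zero d (meet-sib (meet A)) left right
           (subst₂ (λ i j → Meet i j _ _) (sym falls-eq) (sym rises-eq) (meet B))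
  ... | refl = trans (sym (+-identityʳ _)) falls-eq , trans (sym (+-identityʳ _)) rises-eq

  SameFloor : Floor e f → Floor e f → Set
  SameFloor A B = falls A ≡ falls B × rises A ≡ rises B × lowˡ A ≡ lowˡ B × lowʳ A ≡ lowʳ B

  floor-lows : (A B : Floor e f) → falls A ≡ falls B × rises A ≡ rises B → SameFloor A B
  floor-lows (floor _ _ _ _ cu cv _) (floor _ _ _ _ cu' cv' _) (refl , refl) =
    refl , refl , chain-functional cu cu' , chain-functional cv cv'

  floor-unique : (A B : Floor e f) → SameFloor A B
  floor-unique A B with ≤-total (falls A) (falls B)
  ... | inj₁ A≤B = floor-lows A B (floor-no-deeper A B A≤B)
  ... | inj₂ B≤A = floor-lows A B (Data.Product.map sym sym (floor-no-deeper B A B≤A))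

  -- Valleys are determined by their endpoints: the floor fixes the lengths
  -- of the descent and of the ascent, which in turn fix the valley.
  valley-unique : Valley e xs f → Valley e ys f → xs ≡ ys
  valley-unique V W = compare V W (floor-unique (valley-floor V) (valley-floor W))
    where
      compare : ∀ {e xs ys f} (V : Valley e xs f) (W : Valley e ys f) →
                SameFloor (valley-floor V) (valley-floor W) → xs ≡ ys
      compare (rising r)  (rising r')  (_ , h , _) = proj₂ (ascent-unique r r' h)
      compare (falling r) (falling r') (h , _)     = descent-unique r r' h
      compare (bending r _ _ q) (bending r' _ _ q') (h , h' , _)
        with descent-unique r r' h | ascent-unique q q' h'
      ... | refl | refl , refl = refl
      compare (rising [])       (falling [])      _        = refl
      compare (rising [])       (falling (_ ∷ _)) (() , _)
      compare (rising (_ ∷ _))  (falling _)       (_ , () , _)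
      compare (falling [])      (rising [])       _        = refl
      compare (falling [])      (rising (_ ∷ _))  (_ , () , _)
      compare (falling (_ ∷ _)) (rising _)        (() , _)
      compare (rising _)  (bending _ _ u≢v _) (_ , _ , p , q) = ⊥-elim (u≢v (trans (sym p) q))
      compare (falling _) (bending _ _ u≢v _) (_ , _ , p , q) = ⊥-elim (u≢v (trans (sym p) q))
      compare (bending _ _ u≢v _) (rising _)  (_ , _ , p , q) = ⊥-elim (u≢v (trans p (sym q)))
      compare (bending _ _ u≢v _) (falling _) (_ , _ , p , q) = ⊥-elim (u≢v (trans p (sym q)))

  IsValley : List E → Set
  IsValley []       = ⊥
  IsValley (e ∷ xs) = ∃ (Valley e xs)

  valley-ends-unique : ∀ {p q} → IsValley p → IsValley q → SameEnds T p q → p ≡ q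
  valley-ends-unique {e ∷ _} {_ ∷ _} (_ , V) (_ , W) (same-head , same-last)
    with just-injective same-head | just-injective (trans (sym (valley-last V)) (trans same-last (valley-last W)))
  ... | refl | refl = cong (e ∷_) (valley-unique V W)

  _⟶ₜ_ : List E → List E → Set
  _⟶ₜ_ = _⟶_ T

  Redex : List E → Set
  Redex p = ∃ λ p₁ → ∃ λ x → ∃ λ y → ∃ λ z → ∃ λ p₂ → p ≡ p₁ ++ x ∷ y ∷ z ∷ p₂ × Config T x y z

  redex-here : Config T x y z → Redex (x ∷ y ∷ z ∷ xs)
  redex-here c = [] , _ , _ , _ , _ , refl , c

  redex-cons : Redex xs → Redex (x ∷ xs)
  redex-cons {x = x} (p₁ , _ , _ , _ , _ , refl , c) = x ∷ p₁ , _ , _ , _ , _ , refl , c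

  -- A redex in a path can be contracted: x and z are distinct and adjacent.
  redex-step : ∀ {p} → IsPath T p → Redex p → ∃ λ q → p ⟶ₜ q
  redex-step P@(_ , distinct , linked) (p₁ , x , y , z , p₂ , refl , c) =
    _ , step p₁ x y z p₂ P
          (++-∷-nonempty p₁ , allPairs-delete p₁ distinct ,
           linked-delete p₁ linked (link-adj (allPairs-skip p₁ distinct) (config-link c))) c

  step-source : ∀ {p q} → p ⟶ₜ q → IsPath T p
  step-source (step _ _ _ _ _ P _ _) = P

  step-target : ∀ {p q} → p ⟶ₜ q → IsPath T q
  step-target (step _ _ _ _ _ _ Q _) = Q

  step-shorter : ∀ {p q} → p ⟶ₜ q → length q < length p
  step-shorter (step p₁ _ _ _ _ _ _ _) = length-delete p₁

  step-ends : ∀ {p q} → p ⟶ₜ q → SameEnds T p q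
  step-ends (step p₁ x y z p₂ _ _ _) =
    head-++ p₁ , trans (last-++ p₁ x (y ∷ z ∷ p₂)) (sym (last-++ p₁ x (z ∷ p₂)))

  ends-isEquivalence : IsEquivalence (SameEnds T)
  ends-isEquivalence = record
    { refl  = refl , refl
    ; sym   = λ (h , l) → sym h , sym l
    ; trans = λ (h , l) (h' , l') → trans h h' , trans l l'
    }

  open IsEquivalence ends-isEquivalence using () renaming (sym to ends-sym; trans to ends-trans)

  convertible-ends : ∀ {p q} → EqClosure _⟶ₜ_ p q → SameEnds T p q
  convertible-ends = EqClosure.fold ends-isEquivalence step-ends

  reduces-ends : ∀ {p q} → Star _⟶ₜ_ p q → SameEnds T p q
  reduces-ends r = convertible-ends (Star.map fwd r)

  reduces-shorter : ∀ {p q} → Star _⟶ₜ_ p q → length q ≤ length p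
  reduces-shorter ε       = ≤-refl
  reduces-shorter (s ◅ r) = ≤-trans (reduces-shorter r) (<⇒≤ (step-shorter s))

  reduces-path : ∀ {p q} → IsPath T p → Star _⟶ₜ_ p q → IsPath T q
  reduces-path P ε       = P
  reduces-path P (s ◅ r) = reduces-path (step-target s) r

  -- Termination: steps strictly shorten paths.
  terminating : StronglyNormalizing _⟶ₜ_
  terminating = WF.Subrelation.wellFounded step-shorter (On.wellFounded length <-wellFounded)

  -- Scanning from the right:
  -- prepending x to a valley starting at y gives a valley, except when the
  -- first three vertices form one of the configurations (a)-(d).  (Up x y
  -- followed by Down y z would force x = z, excluded in a path.)
  extend : Link x y → Valley y xs f → All (x ≢_) (y ∷ xs) → Redex (x ∷ y ∷ xs) ⊎ Valley x (y ∷ xs) f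
  extend (down d) (rising []) _         = inj₂ (falling (d ∷ []))
  extend (down d) (rising (u ∷ _)) _    = inj₁ (redex-here (config-b d u))
  extend (down d) (falling r) _         = inj₂ (falling (d ∷ r))
  extend (down d) (bending r s ne q) _  = inj₂ (bending (d ∷ r) s ne q)
  extend (up u) (rising q) _            = inj₂ (rising (u ∷ q))
  extend (up u) (falling []) _          = inj₂ (rising (u ∷ []))
  extend (up u) (falling (d ∷ _)) (_ ∷ x≢z ∷ _)       = ⊥-elim (x≢z (down-functional u d))
  extend (up u) (bending [] s ne _) _                  = inj₁ (redex-here (config-d u s ne))
  extend (up u) (bending (d ∷ _) _ _ _) (_ ∷ x≢z ∷ _) = ⊥-elim (x≢z (down-functional u d))
  extend (side s) (rising q) (x≢y ∷ _)                 = inj₂ (bending [] s x≢y q)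
  extend (side s) (falling []) (x≢y ∷ _)               = inj₂ (bending [] s x≢y [])
  extend (side s) (falling (d ∷ _)) (x≢y ∷ _)          = inj₁ (redex-here (config-c s x≢y d))
  extend (side s) (bending [] s' ne _) (x≢y ∷ _)       = inj₁ (redex-here (config-a s x≢y s' ne))
  extend (side s) (bending (d ∷ _) _ _ _) (x≢y ∷ _)    = inj₁ (redex-here (config-c s x≢y d))

  valley-or-redex : ∀ {p} → IsPath T p → Redex p ⊎ IsValley p
  valley-or-redex {[]}     (nonempty , _)     = ⊥-elim (nonempty refl)
  valley-or-redex {x ∷ xs} (_ , distinct , linked) = scan x xs linked distinct
    where
      scan : ∀ x xs → Linked (Adj T) (x ∷ xs) → Unique (x ∷ xs) → Redex (x ∷ xs) ⊎ ∃ (Valley x xs)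
      scan x []       _       _             = inj₂ (x , falling [])
      scan x (y ∷ xs) (a ∷ l) (x∉ ∷ distinct) with scan y xs l distinct
      ... | inj₁ r       = inj₁ (redex-cons r)
      ... | inj₂ (f , V) = Data.Sum.map₂ (f ,_) (extend (adj-link a) V x∉)

  normalise : ∀ {p} → IsPath T p → ∃ λ q → Star _⟶ₜ_ p q × IsValley q
  normalise {p} = go p (<-wellFounded (length p))
    where
      go : ∀ p → Acc _<_ (length p) → IsPath T p → ∃ λ q → Star _⟶ₜ_ p q × IsValley q
      go p (acc smaller) P with valley-or-redex P
      ... | inj₂ V = p , ε , V
      ... | inj₁ r with redex-step P r
      ...   | q , s with go q (smaller (step-shorter s)) (step-target s)
      ...     | q' , r' , V = q' , s ◅ r' , V

  common-valley : ∀ {p q} → IsPath T p → IsPath T q → SameEnds T p q →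
                  ∃ λ w → Star _⟶ₜ_ p w × Star _⟶ₜ_ q w × IsValley w
  common-valley P Q same with normalise P | normalise Q
  ... | w , r , V | w' , r' , V'
    with valley-ends-unique V V' (ends-trans (ends-sym (reduces-ends r)) (ends-trans same (reduces-ends r')))
  ... | refl = w , r , r' , V

  -- A valley is irreducible: a reduct would normalise to a strictly shorter
  -- valley with the same endpoints.
  valley-normal : ∀ {p} → IsValley p → IsNormalForm _⟶ₜ_ p
  valley-normal V (q , s) with normalise (step-target s)
  ... | w , r , W with valley-ends-unique V W (ends-trans (step-ends s) (reduces-ends r))
  ... | refl = ≤⇒≯ (reduces-shorter r) (step-shorter s)

  normal-valley : ∀ {p} → IsPath T p → IsNormalForm _⟶ₜ_ p → IsValley p
  normal-valley P irreducible with valley-or-redex P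
  ... | inj₁ r = ⊥-elim (irreducible (redex-step P r))
  ... | inj₂ V = V

  -- A valley is a min-path: any path with its endpoints reduces to it.
  valley-minimal : ∀ {p} → IsPath T p → IsValley p → MinPath T p
  valley-minimal {p} P V = P , shortest
    where
      shortest : ∀ q → IsPath T q → SameEnds T p q → length p ≤ length q
      shortest q Q same with common-valley P Q same
      ... | w , r , r' , W with valley-ends-unique V W (reduces-ends r)
      ... | refl = reduces-shorter r'

  minimal-normal : ∀ {p} → MinPath T p → IsNormalForm _⟶ₜ_ p
  minimal-normal (_ , shortest) (q , s) = ≤⇒≯ (shortest q (step-target s) (step-ends s)) (step-shorter s)

  -- Confluence: two reducts of a path reduce to the valley with its ends.
  confluent : Confluent _⟶ₜ_
  confluent ε           r' = _ , r' , ε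
  confluent r@(s ◅ _)   r'
    with common-valley (reduces-path (step-source s) r) (reduces-path (step-source s) r')
                       (ends-trans (ends-sym (reduces-ends r)) (reduces-ends r'))
  ... | w , rw , rw' , _ = w , rw , rw'

  complete : ∀ p q → IsPath T p → IsPath T q → SameEnds T p q → EqClosure _⟶ₜ_ p q
  complete p q P Q same with common-valley P Q same
  ... | _ , r , r' , _ = Star.map fwd r ◅◅ EqClosure.symmetric _⟶ₜ_ (Star.map fwd r')

  -- A list linked by descending steps is a descending path: levels
  -- strictly decrease along it, so its vertices are distinct.
  descending : ∀ {p} → ¬ (p ≡ []) → Linked (DescStep T) p → Descending T p
  descending nonempty l = (nonempty , distinct , Linked.map descStep-adj l) , l
    where
      descStep-adj : DescStep T x y → Adj T x y
      descStep-adj st = link-adj (down-distinct (descStep-down st)) (down (descStep-down st))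

      lower : Linked (λ x y → lv y < lv x) _
      lower = Linked.map (λ st → ≤-reflexive (sym (proj₂ st))) l

      distinct : Unique _
      distinct = AllPairs.map (λ lt eq → <-irrefl (cong lv (sym eq)) lt)
                   (Linked.Linked⇒AllPairs (λ p q → <-trans q p) lower)

  run-descending : Run Down e xs f → Descending T (e ∷ xs)
  run-descending r = descending (λ ()) (Linked.map down-descStep (run-linked r))

  run-ascending : Run Up e xs f → Ascending T (e ∷ xs)
  run-ascending {e} {xs} r =
    descending reversed-nonempty (linked-reverse (Linked.map down-descStep (run-linked r)))
    where
      reversed-nonempty : ¬ (reverse (e ∷ xs) ≡ [])
      reversed-nonempty eq with trans (sym (length-reverse (e ∷ xs))) (cong length eq)
      ... | ()

  ascending-run : Ascending T (e ∷ xs) → ∃ (Run Up e xs)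
  ascending-run {e} {xs} (_ , l) =
    linked-run (Linked.map descStep-down
      (subst (Linked (flip (DescStep T))) (reverse-involutive (e ∷ xs)) (linked-reverse l)))

  valley-type : ∀ {p} → IsPath T p → IsValley p → TypeI T p ⊎ TypeII T p
  valley-type {_ ∷ _} _ (_ , rising r)  = inj₁ (inj₂ (run-ascending r))
  valley-type {_ ∷ _} _ (_ , falling r) = inj₁ (inj₁ (run-descending r))
  valley-type {e ∷ _} P (_ , bending {xs = xs} {u} {v} {ys} r s u≢v q) with run-snoc r
  ... | q₁ , split =
    inj₂ (P , q₁ , u , v , ys , regroup , subst (Descending T) split (run-descending r) ,
          sib-dashed s u≢v , run-ascending q)
    where
      regroup : e ∷ xs ++ v ∷ ys ≡ q₁ ++ u ∷ v ∷ ys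
      regroup = trans (cong (_++ v ∷ ys) split) (++-assoc q₁ [ u ] (v ∷ ys))

  type-valley : ∀ {p} → IsPath T p → TypeI T p ⊎ TypeII T p → IsValley p
  type-valley {[]}    (nonempty , _) _ = ⊥-elim (nonempty refl)
  type-valley {_ ∷ _} _ (inj₁ (inj₁ (_ , l))) =
    Data.Product.map₂ falling (linked-run (Linked.map descStep-down l))
  type-valley {_ ∷ _} _ (inj₁ (inj₂ A))       = Data.Product.map₂ rising (ascending-run A)
  type-valley {_ ∷ _} _ (inj₂ (_ , q₁ , u , v , q₂ , p≡ , (_ , ld) , dashed , A))
    with linked-snoc-run q₁ (Linked.map descStep-down ld) | ascending-run A
  ... | e , xs , split , r | f , q =
    subst IsValley (trans regroup (sym p≡)) (f , bending r (dashed-sib dashed) (proj₁ dashed) q)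
    where
      regroup : e ∷ xs ++ v ∷ q₂ ≡ q₁ ++ u ∷ v ∷ q₂
      regroup = trans (cong (_++ v ∷ q₂) (sym split)) (++-assoc q₁ [ u ] (v ∷ q₂))

lemma11 : (n : ℕ) (T : Tree n) →
    StronglyNormalizing (_⟶_ T)
    × Confluent (_⟶_ T)
    × (∀ p q → IsPath T p → IsPath T q → SameEnds T p q → EqClosure (_⟶_ T) p q)
    × (∀ p q → IsPath T p → IsPath T q → EqClosure (_⟶_ T) p q → SameEnds T p q)
    × (∀ p → IsPath T p → (IsNormalForm (_⟶_ T) p ⇔ (TypeI T p ⊎ TypeII T p)))
    × (∀ p → IsPath T p → (IsNormalForm (_⟶_ T) p ⇔ MinPath T p))
lemma11 n T =
    terminating
  , confluent
  , complete
  , (λ _ _ _ _ → convertible-ends)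
  , (λ p P → mk⇔ (λ nf → valley-type P (normal-valley P nf)) (λ t → valley-normal (type-valley P t)))
  , (λ p P → mk⇔ (λ nf → valley-minimal P (normal-valley P nf)) minimal-normal)
  where open ValleyPaths T
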